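{- Let $T_1,T_2$ be planar rooted trees, each with $n$ non-root nodes, and let $R_1=\rho(T_1)$, $R_2=\rho(T_2)$. Then for every $k\in\{1,\dots,n\}$, $|R_1(k)|\geq|R_2(k)|$ if and only if $R_1(k)\supseteq R_2(k)$.
   Context: In a planar (ordered) rooted tree the nodes are labelled by the preorder traversal (root first, then recursively the subtrees of its children from left to right), the root getting label $0$ and the non-root nodes labels $1,\dots,n$. For such a tree $T$, $\rho(T)$ is the strict partial order $R$ on $\{1,\dots,n\}$ with $xRy$ iff neither of $x,y$ is an ancestor of the other and $x$ lies to the left of $y$ in $T$. For a relation $R$, $R(k)=\{y: kRy\}$. -}

module Defs where

open import Data.Nat using (ℕ; zero; suc; _+_; _<_)
open import Data.List using (List; []; _∷_; length; lookup; take; map; sum)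
open import Data.List.Relation.Unary.Unique.Propositional using (Unique)
open import Data.List.Membership.Propositional using (_∈_)
open import Data.Fin using (Fin; toℕ)
open import Data.Product using (Σ; _×_; ∃)
open import Relation.Nullary using (¬_)
open import Relation.Binary.PropositionalEquality using (_≡_)

data Tree : Set where
  node : List Tree → Tree

mutual
  size : Tree → ℕ
  size (node ts) = suc (sizes ts)

  sizes : List Tree → ℕ
  sizes [] = 0
  sizes (t ∷ ts) = size t + sizes ts

nonRoot : Tree → ℕ
nonRoot (node ts) = sizes ts

-- Nodes of a tree, as addresses (path of child indices from the root).
data Node : Tree → Set where
  here  : ∀ {ts} → Node (node ts)
  child : ∀ {ts} (i : Fin (length ts)) → Node (lookup ts i) → Node (node ts)

-- preorder label: root 0, then subtrees of the children from left to right
label : ∀ {t} → Node t → ℕ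
label here = 0
label {node ts} (child i a) = suc (sizes (take (toℕ i) ts) + label a)

-- strict ancestor relation: Anc a b iff a is a proper ancestor of b
data Anc : ∀ {t} → Node t → Node t → Set where
  root-anc  : ∀ {ts} (i : Fin (length ts)) (b : Node (lookup ts i)) →
              Anc {node ts} here (child i b)
  child-anc : ∀ {ts} (i : Fin (length ts)) {a b : Node (lookup ts i)} →
              Anc a b → Anc {node ts} (child i a) (child i b)

data Left : ∀ {t} → Node t → Node t → Set where
  diverge : ∀ {ts} (i j : Fin (length ts)) (a : Node (lookup ts i))
              (b : Node (lookup ts j)) → toℕ i < toℕ j →
              Left {node ts} (child i a) (child j b)
  inside  : ∀ {ts} (i : Fin (length ts)) {a b : Node (lookup ts i)} →
              Left a b → Left {node ts} (child i a) (child i b)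

ρ : Tree → ℕ → ℕ → Set
ρ t x y = Σ (Node t) λ a → Σ (Node t) λ b →
  label a ≡ x × label b ≡ y × ¬ Anc a b × ¬ Anc b a × Left a b

img : (ℕ → ℕ → Set) → ℕ → ℕ → Set
img R k y = R k y

-- a list enumerates a predicate exactly and without repetition;
-- its length is then the cardinality of the (finite) set
Enumerates : List ℕ → (ℕ → Set) → Set
Enumerates l P = Unique l × (∀ y → y ∈ l → P y) × (∀ y → P y → y ∈ l)

-- Labels are assigned in preorder, so the labels of the subtree rooted at a node a
-- form an interval [label a, e_a), and b is to the right of a without either being
-- an ancestor of the other exactly when label b ≥ e_a.  Hence ρ(T)(k) = [e, n] for
-- some e (empty if e > n), and two final segments of {0,…,n} are nested, the larger
-- containing the smaller.
module Submission where

open import Defs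
open import Data.Nat using (ℕ; zero; suc; _+_; _≤_; _≥_; _<_; z≤n; s≤s; s≤s⁻¹; _≤?_; _<?_)
open import Data.Nat.Properties
open import Data.List using (List; []; _∷_; length; lookup; take; _++_)
open import Data.List.Properties using (length-++)
open import Data.List.Membership.Propositional using (_∈_; _∉_)
open import Data.List.Membership.Propositional.Properties using (∈-∃++; ∈-++⁺ˡ; ∈-++⁺ʳ; ∈-++⁻)
open import Data.List.Relation.Unary.All using (tabulate) renaming (lookup to lookupAll)
open import Data.List.Relation.Unary.AllPairs using (_∷_)
open import Data.List.Relation.Unary.Any using (here; there)
open import Data.List.Relation.Unary.Unique.Propositional using (Unique)
open import Data.Fin using (Fin; toℕ) renaming (zero to fzero; suc to fsuc)
open import Data.Fin.Properties using (toℕ-injective)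
open import Data.Product using (_×_; _,_; Σ; ∃; proj₁)
open import Data.Sum using (inj₁; inj₂)
open import Data.Empty using (⊥-elim)
open import Function.Bundles using (_⇔_; mk⇔; Equivalence)
open import Relation.Nullary using (¬_; yes; no)
open import Relation.Binary using (tri<; tri≈; tri>)
open import Relation.Binary.PropositionalEquality

open Equivalence using (to; from)

private
  variable
    P Q : ℕ → Set
    l₁ l₂ : List ℕ

length-≤-of-⊆ : {xs ys : List ℕ} → Unique xs → (∀ z → z ∈ xs → z ∈ ys) →
  length xs ≤ length ys
length-≤-of-⊆ {[]} _ _ = z≤n
length-≤-of-⊆ {x ∷ xs} {ys} (x∉xs ∷ xs!) xs⊆ys with ∈-∃++ (xs⊆ys x (here refl))
... | ys₁ , ys₂ , refl = begin
  suc (length xs)               ≤⟨ s≤s (length-≤-of-⊆ xs! xs⊆ys₁++ys₂) ⟩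
  suc (length (ys₁ ++ ys₂))     ≡⟨ cong suc (length-++ ys₁) ⟩
  suc (length ys₁ + length ys₂) ≡⟨ +-suc (length ys₁) (length ys₂) ⟨
  length ys₁ + length (x ∷ ys₂) ≡⟨ length-++ ys₁ ⟨
  length (ys₁ ++ x ∷ ys₂)       ∎
  where
  open ≤-Reasoning
  xs⊆ys₁++ys₂ : ∀ z → z ∈ xs → z ∈ ys₁ ++ ys₂
  xs⊆ys₁++ys₂ z z∈xs with ∈-++⁻ ys₁ (xs⊆ys z (there z∈xs))
  ... | inj₁ z∈ys₁ = ∈-++⁺ˡ z∈ys₁
  ... | inj₂ (here z≡x) = ⊥-elim (lookupAll x∉xs z∈xs (sym z≡x))
  ... | inj₂ (there z∈ys₂) = ∈-++⁺ʳ ys₁ z∈ys₂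

length-<-of-⊂ : {xs ys : List ℕ} {w : ℕ} → Unique xs → (∀ z → z ∈ xs → z ∈ ys) →
  w ∈ ys → w ∉ xs → length xs < length ys
length-<-of-⊂ {xs} {ys} {w} xs! xs⊆ys w∈ys w∉xs = length-≤-of-⊆ w∷xs! w∷xs⊆ys
  where
  w∷xs! : Unique (w ∷ xs)
  w∷xs! = tabulate (λ z∈xs w≡z → w∉xs (subst (_∈ xs) (sym w≡z) z∈xs)) ∷ xs!
  w∷xs⊆ys : ∀ z → z ∈ w ∷ xs → z ∈ ys
  w∷xs⊆ys z (here refl) = w∈ys
  w∷xs⊆ys z (there z∈xs) = xs⊆ys z z∈xs

Enumerates-length-mono : Enumerates l₁ P → Enumerates l₂ Q → (∀ y → Q y → P y) →
  length l₂ ≤ length l₁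
Enumerates-length-mono (_ , _ , P⊆l₁) (l₂! , l₂⊆Q , _) Q⊆P =
  length-≤-of-⊆ l₂! (λ z z∈l₂ → P⊆l₁ z (Q⊆P z (l₂⊆Q z z∈l₂)))

_∈[_,_⟩ : ℕ → ℕ → ℕ → Set
y ∈[ m , N ⟩ = m ≤ y × y < N

final-segments-length-≥⇒⊇ : {m₁ m₂ N : ℕ} →
  Enumerates l₁ P → Enumerates l₂ Q →
  (∀ y → P y ⇔ y ∈[ m₁ , N ⟩) → (∀ y → Q y ⇔ y ∈[ m₂ , N ⟩) →
  length l₁ ≥ length l₂ → ∀ y → Q y → P y
final-segments-length-≥⇒⊇ {l₁ = l₁} {l₂ = l₂} {m₁ = m₁} {m₂}
  (l₁! , l₁⊆P , _) (_ , _ , Q⊆l₂) P⇔ Q⇔ l₂≤l₁ y Qy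
  with Q⇔ y .to Qy | m₁ ≤? m₂
... | m₂≤y , y<N | yes m₁≤m₂ = P⇔ y .from (≤-trans m₁≤m₂ m₂≤y , y<N)
... | m₂≤y , y<N | no m₁≰m₂ = ⊥-elim (≤⇒≯ l₂≤l₁ (length-<-of-⊂ l₁! l₁⊆l₂ m₂∈l₂ m₂∉l₁))
  where
  m₂<m₁ : m₂ < m₁
  m₂<m₁ = ≰⇒> m₁≰m₂
  l₁⊆l₂ : ∀ z → z ∈ l₁ → z ∈ l₂
  l₁⊆l₂ z z∈l₁ with P⇔ z .to (l₁⊆P z z∈l₁)
  ... | m₁≤z , z<N = Q⊆l₂ z (Q⇔ z .from (≤-trans (<⇒≤ m₂<m₁) m₁≤z , z<N))
  m₂∈l₂ : m₂ ∈ l₂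
  m₂∈l₂ = Q⊆l₂ m₂ (Q⇔ m₂ .from (≤-refl , ≤-<-trans m₂≤y y<N))
  m₂∉l₁ : m₂ ∉ l₁
  m₂∉l₁ m₂∈l₁ = <⇒≱ m₂<m₁ (proj₁ (P⇔ m₂ .to (l₁⊆P m₂ m₂∈l₁)))

offset : (ts : List Tree) → Fin (length ts) → ℕ
offset ts i = sizes (take (toℕ i) ts)

offset-+-size-≤-offset : ∀ ts (i j : Fin (length ts)) → toℕ i < toℕ j →
  offset ts i + size (lookup ts i) ≤ offset ts j
offset-+-size-≤-offset (t ∷ ts) fzero (fsuc j) _ = m≤m+n (size t) (offset ts j)
offset-+-size-≤-offset (t ∷ ts) (fsuc i) (fsuc j) (s≤s i<j) = begin
  size t + offset ts i + size (lookup ts i)   ≡⟨ +-assoc (size t) (offset ts i) _ ⟩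
  size t + (offset ts i + size (lookup ts i)) ≤⟨ +-monoʳ-≤ (size t) (offset-+-size-≤-offset ts i j i<j) ⟩
  size t + offset ts j                        ∎
  where open ≤-Reasoning

offset-+-size-≤-sizes : ∀ ts (i : Fin (length ts)) → offset ts i + size (lookup ts i) ≤ sizes ts
offset-+-size-≤-sizes (t ∷ ts) fzero = m≤m+n (size t) (sizes ts)
offset-+-size-≤-sizes (t ∷ ts) (fsuc i) = begin
  size t + offset ts i + size (lookup ts i)   ≡⟨ +-assoc (size t) (offset ts i) _ ⟩
  size t + (offset ts i + size (lookup ts i)) ≤⟨ +-monoʳ-≤ (size t) (offset-+-size-≤-sizes ts i) ⟩
  size t + sizes ts                           ∎
  where open ≤-Reasoning

subtreeSize : ∀ {t} → Node t → ℕ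
subtreeSize {t} here = size t
subtreeSize (child i a) = subtreeSize a

subtreeSize-positive : ∀ {t} (a : Node t) → 0 < subtreeSize a
subtreeSize-positive here = s≤s z≤n
subtreeSize-positive (child i a) = subtreeSize-positive a

subtreeEnd : ∀ {t} → Node t → ℕ
subtreeEnd a = label a + subtreeSize a

subtreeEnd-child : ∀ ts (i : Fin (length ts)) (a : Node (lookup ts i)) →
  subtreeEnd {node ts} (child i a) ≡ suc (offset ts i + subtreeEnd a)
subtreeEnd-child ts i a = cong suc (+-assoc (offset ts i) (label a) (subtreeSize a))

label-<-subtreeEnd : ∀ {t} (a : Node t) → label a < subtreeEnd a
label-<-subtreeEnd a = m<m+n (label a) (subtreeSize-positive a)

subtreeEnd-≤-size : ∀ {t} (a : Node t) → subtreeEnd a ≤ size t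
subtreeEnd-≤-size here = ≤-refl
subtreeEnd-≤-size {node ts} (child i a) = begin
  subtreeEnd {node ts} (child i a)           ≡⟨ subtreeEnd-child ts i a ⟩
  suc (offset ts i + subtreeEnd a)           ≤⟨ s≤s (+-monoʳ-≤ (offset ts i) (subtreeEnd-≤-size a)) ⟩
  suc (offset ts i + size (lookup ts i))     ≤⟨ s≤s (offset-+-size-≤-sizes ts i) ⟩
  suc (sizes ts)                             ∎
  where open ≤-Reasoning

label-<-size : ∀ {t} (a : Node t) → label a < size t
label-<-size a = <-≤-trans (label-<-subtreeEnd a) (subtreeEnd-≤-size a)

subtreeEnd-≤-label-of-earlier-child : ∀ {ts} (i j : Fin (length ts))
  (a : Node (lookup ts i)) (b : Node (lookup ts j)) → toℕ i < toℕ j →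
  subtreeEnd {node ts} (child i a) ≤ label {node ts} (child j b)
subtreeEnd-≤-label-of-earlier-child {ts} i j a b i<j = begin
  subtreeEnd {node ts} (child i a)           ≡⟨ subtreeEnd-child ts i a ⟩
  suc (offset ts i + subtreeEnd a)           ≤⟨ s≤s (+-monoʳ-≤ (offset ts i) (subtreeEnd-≤-size a)) ⟩
  suc (offset ts i + size (lookup ts i))     ≤⟨ s≤s (offset-+-size-≤-offset ts i j i<j) ⟩
  suc (offset ts j)                          ≤⟨ s≤s (m≤m+n (offset ts j) (label b)) ⟩
  label {node ts} (child j b)                ∎
  where open ≤-Reasoning

label-<-label-of-earlier-child : ∀ {ts} (i j : Fin (length ts))
  (a : Node (lookup ts i)) (b : Node (lookup ts j)) → toℕ i < toℕ j →
  label {node ts} (child i a) < label {node ts} (child j b)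
label-<-label-of-earlier-child {ts} i j a b i<j =
  <-≤-trans (label-<-subtreeEnd {node ts} (child i a)) (subtreeEnd-≤-label-of-earlier-child i j a b i<j)

label-injective : ∀ {t} (a b : Node t) → label a ≡ label b → a ≡ b
label-injective here here _ = refl
label-injective {node ts} (child i a) (child j b) eq with <-cmp (toℕ i) (toℕ j)
... | tri< i<j _ _ = ⊥-elim (<-irrefl eq (label-<-label-of-earlier-child i j a b i<j))
... | tri> _ _ j<i = ⊥-elim (<-irrefl (sym eq) (label-<-label-of-earlier-child j i b a j<i))
... | tri≈ _ i≡j _ with toℕ-injective i≡j
... | refl = cong (child i) (label-injective a b (+-cancelˡ-≡ (offset ts i) _ _ (suc-injective eq)))

mutual
  label-surjective : ∀ t y → y < size t → Σ (Node t) λ a → label a ≡ y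
  label-surjective (node ts) zero _ = here , refl
  label-surjective (node ts) (suc y) (s≤s y<sizes) with offset-label-surjective ts y y<sizes
  ... | i , b , eq = child i b , cong suc eq

  offset-label-surjective : ∀ ts y → y < sizes ts →
    Σ (Fin (length ts)) λ i → Σ (Node (lookup ts i)) λ b → offset ts i + label b ≡ y
  offset-label-surjective (t ∷ ts) y y<sizes with y <? size t
  ... | yes y<size with label-surjective t y y<size
  ...   | b , eq = fzero , b , eq
  offset-label-surjective (t ∷ ts) y y<sizes | no y≮size
    with m≤n⇒∃[o]m+o≡n (≮⇒≥ y≮size)
  ... | y′ , refl with offset-label-surjective ts y′ (+-cancelˡ-< (size t) y′ (sizes ts) y<sizes)
  ...   | i , b , eq = fsuc i , b , trans (+-assoc (size t) (offset ts i) (label b)) (cong (size t +_) eq)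

Anc⇒label-< : ∀ {t} {a b : Node t} → Anc a b → label a < label b
Anc⇒label-< (root-anc i b) = s≤s z≤n
Anc⇒label-< {node ts} (child-anc i p) = s≤s (+-monoʳ-< (offset ts i) (Anc⇒label-< p))

Anc⇒label-<-subtreeEnd : ∀ {t} {a b : Node t} → Anc a b → label b < subtreeEnd a
Anc⇒label-<-subtreeEnd {node ts} (root-anc i b) =
  s≤s (<-≤-trans (+-monoʳ-< (offset ts i) (label-<-size b)) (offset-+-size-≤-sizes ts i))
Anc⇒label-<-subtreeEnd {node ts} (child-anc i {a} p) =
  ≤-trans (s≤s (+-monoʳ-< (offset ts i) (Anc⇒label-<-subtreeEnd p))) (≤-reflexive (sym (subtreeEnd-child ts i a)))

Left⇒subtreeEnd-≤-label : ∀ {t} {a b : Node t} → Left a b → subtreeEnd a ≤ label b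
Left⇒subtreeEnd-≤-label (diverge i j a b i<j) = subtreeEnd-≤-label-of-earlier-child i j a b i<j
Left⇒subtreeEnd-≤-label {node ts} (inside i {a} p) =
  ≤-trans (≤-reflexive (subtreeEnd-child ts i a)) (s≤s (+-monoʳ-≤ (offset ts i) (Left⇒subtreeEnd-≤-label p)))

subtreeEnd-≤-label⇒Left : ∀ {t} (a b : Node t) → subtreeEnd a ≤ label b → Left a b
subtreeEnd-≤-label⇒Left here b end≤b = ⊥-elim (≤⇒≯ end≤b (label-<-size b))
subtreeEnd-≤-label⇒Left (child i a) here ()
subtreeEnd-≤-label⇒Left {node ts} (child i a) (child j b) end≤b with <-cmp (toℕ i) (toℕ j)
... | tri< i<j _ _ = diverge i j a b i<j
... | tri> _ _ j<i = ⊥-elim (≤⇒≯ end≤b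
  (<-trans (label-<-label-of-earlier-child j i b a j<i) (label-<-subtreeEnd {node ts} (child i a))))
... | tri≈ _ i≡j _ with toℕ-injective i≡j
... | refl = inside i (subtreeEnd-≤-label⇒Left a b (+-cancelˡ-≤ (offset ts i) _ _
  (s≤s⁻¹ (≤-trans (≤-reflexive (sym (subtreeEnd-child ts i a))) end≤b))))

unrelated-left⇔subtreeEnd-≤-label : ∀ {t} (a b : Node t) →
  (¬ Anc a b × ¬ Anc b a × Left a b) ⇔ subtreeEnd a ≤ label b
unrelated-left⇔subtreeEnd-≤-label a b = mk⇔
  (λ (_ , _ , a-left-b) → Left⇒subtreeEnd-≤-label a-left-b)
  (λ end≤b → (λ a<b → ≤⇒≯ end≤b (Anc⇒label-<-subtreeEnd a<b))
           , (λ b<a → <⇒≱ (<-trans (Anc⇒label-< b<a) (label-<-subtreeEnd a)) end≤b)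
           , subtreeEnd-≤-label⇒Left a b end≤b)

ρ-image-final-segment : ∀ t k → ∃ λ m → ∀ y → ρ t k y ⇔ y ∈[ m , size t ⟩
ρ-image-final-segment t k with k <? size t
... | no k≮size = size t , λ y → mk⇔
  (λ (a , _ , a↦k , _) → ⊥-elim (k≮size (subst (_< size t) a↦k (label-<-size a))))
  (λ (size≤y , y<size) → ⊥-elim (≤⇒≯ size≤y y<size))
... | yes k<size with label-surjective t k k<size
... | a₀ , refl = subtreeEnd a₀ , λ y → mk⇔ (image⊆ y) (⊆image y)
  where
  image⊆ : ∀ y → ρ t (label a₀) y → y ∈[ subtreeEnd a₀ , size t ⟩
  image⊆ _ (a , b , a≡a₀ , refl , unrelated-left)
    with label-injective a a₀ a≡a₀
  ... | refl = unrelated-left⇔subtreeEnd-≤-label a b .to unrelated-left , label-<-size b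
  ⊆image : ∀ y → y ∈[ subtreeEnd a₀ , size t ⟩ → ρ t (label a₀) y
  ⊆image y (end≤y , y<size) with label-surjective t y y<size
  ... | b , refl = a₀ , b , refl , refl , unrelated-left⇔subtreeEnd-≤-label a₀ b .from end≤y

size≡suc-nonRoot : ∀ t → size t ≡ suc (nonRoot t)
size≡suc-nonRoot (node ts) = refl

mainTheorem8 : (n : ℕ) (T₁ T₂ : Tree) → nonRoot T₁ ≡ n → nonRoot T₂ ≡ n →
    (k : ℕ) → 1 ≤ k → k ≤ n →
    (l₁ l₂ : List ℕ) → Enumerates l₁ (img (ρ T₁) k) → Enumerates l₂ (img (ρ T₂) k) →
    (length l₁ ≥ length l₂ → (∀ y → img (ρ T₂) k y → img (ρ T₁) k y)) ×
    ((∀ y → img (ρ T₂) k y → img (ρ T₁) k y) → length l₁ ≥ length l₂)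
mainTheorem8 n T₁ T₂ T₁-n T₂-n k _ _ l₁ l₂ enum₁ enum₂
  with ρ-image-final-segment T₁ k | ρ-image-final-segment T₂ k
... | m₁ , R₁k⇔ | m₂ , R₂k⇔ =
    final-segments-length-≥⇒⊇ enum₁ enum₂ R₁k⇔ (λ y → subst (λ N → ρ T₂ k y ⇔ y ∈[ m₂ , N ⟩) sizes≡ (R₂k⇔ y))
  , Enumerates-length-mono enum₁ enum₂
  where
  sizes≡ : size T₂ ≡ size T₁
  sizes≡ = begin
    size T₂          ≡⟨ size≡suc-nonRoot T₂ ⟩
    suc (nonRoot T₂) ≡⟨ cong suc (trans T₂-n (sym T₁-n)) ⟩
    suc (nonRoot T₁) ≡⟨ size≡suc-nonRoot T₁ ⟨
    size T₁          ∎
    where open ≡-Reasoning
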